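{- Let $\mathsf{CS}$ be an arbitrary constant specification for $\mathsf{JE}$. For every formula $F$: $\mathsf{JE}_{\mathsf{CS}} \vdash F$ if and only if $\varepsilon \Vdash F$ for every basic model $\varepsilon$ for $\mathsf{JE}_{\mathsf{CS}}$.
   Context: Language. Fix countably many proof constants $\alpha_1,\alpha_2,\dots$, proof variables $\xi_1,\xi_2,\dots$, and a countable set $\mathsf{Prop}$ of atomic propositions. Proof terms: $\lambda ::= \alpha_i \mid \xi_i \mid (\lambda\cdot\lambda) \mid (\lambda+\lambda) \mid\ !\lambda$; their set is $\mathsf{PTm}$. Justification terms: $t ::= \mathsf{e}(\lambda)$ with $\lambda\in\mathsf{PTm}$; their set is $\mathsf{JTm}$. Formulas: $F ::= P \mid \bot \mid (F\to F) \mid \lambda : F \mid [t]F$ with $P\in\mathsf{Prop}$, $\lambda\in\mathsf{PTm}$, $t\in\mathsf{JTm}$; the set of formulas is $\mathsf{Fm}$, and $\neg,\wedge,\vee,\leftrightarrow$ are the usual classical abbreviations. Axioms of $\mathsf{JE}$: all instances of classical propositional tautologies, and all instances of (j) $\lambda:(F\to G)\to(\kappa:F\to \lambda\cdot\kappa:G)$; (j+$_1$) $(\lambda:F\vee\kappa:F)\to(\lambda+\kappa):F$; (jt) $\lambda:F\to F$; (j4) $\lambda:F\to\ !\lambda:\lambda:F$; (je) $(\lambda:(F\to G)\wedge\lambda:(G\to F))\to([\mathsf{e}(\lambda)]F\to[\mathsf{e}(\lambda)]G)$; (je+) $([\mathsf{e}(\lambda)]F\vee[\mathsf{e}(\kappa)]F)\to[\mathsf{e}(\lambda+\kappa)]F$.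 A constant specification $\mathsf{CS}$ is any set of pairs $(\alpha,A)$ with $\alpha$ a proof constant and $A$ an axiom of $\mathsf{JE}$. The logic $\mathsf{JE}_{\mathsf{CS}}$ is the Hilbert system whose axioms are those of $\mathsf{JE}$ and whose rules are modus ponens and axiom necessitation: infer $\alpha:A$ whenever $(\alpha,A)\in\mathsf{CS}$. Semantics. For sets of formulas $X,Y$ and a proof term $\lambda$: $\lambda:X=\{\lambda:F\mid F\in X\}$; $X\cdot Y=\{F\mid G\to F\in X \text{ for some } G\in Y\}$; $X\odot Y=\{F\mid F\to G\in X \text{ and } G\to F\in X \text{ for some } G\in Y\}$. A basic evaluation for $\mathsf{JE}_{\mathsf{CS}}$ is a function $\varepsilon$ with $\varepsilon(P)\in\{0,1\}$ for $P\in\mathsf{Prop}$ and $\varepsilon:\mathsf{PTm}\cup\mathsf{JTm}\to\mathcal P(\mathsf{Fm})$ such that for all $\lambda,\kappa\in\mathsf{PTm}$: (1) $\varepsilon(\lambda)\cdot\varepsilon(\kappa)\subseteq\varepsilon(\lambda\cdot\kappa)$; (2) $\varepsilon(\lambda)\cup\varepsilon(\kappa)\subseteq\varepsilon(\lambda+\kappa)$; (3) $F\in\varepsilon(\lambda)$ if $(\lambda,F)\in\mathsf{CS}$; (4) $\lambda:\varepsilon(\lambda)\subseteq\varepsilon(!\lambda)$; (5) $\varepsilon(\lambda)\odot\varepsilon(\mathsf{e}(\lambda))\subseteq\varepsilon(\mathsf{e}(\lambda))$; (6) $\varepsilon(\mathsf{e}(\lambda))\cup\varepsilon(\mathsf{e}(\kappa))\subseteq\varepsilon(\mathsf{e}(\lambda+\kappa))$.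 Truth: $\varepsilon\nVdash\bot$; $\varepsilon\Vdash P$ iff $\varepsilon(P)=1$; $\varepsilon\Vdash F\to G$ iff $\varepsilon\nVdash F$ or $\varepsilon\Vdash G$; $\varepsilon\Vdash\lambda:F$ iff $F\in\varepsilon(\lambda)$; $\varepsilon\Vdash[t]F$ iff $F\in\varepsilon(t)$. A basic model is a basic evaluation that is factive: $\varepsilon\Vdash\lambda:F$ implies $\varepsilon\Vdash F$ for all $\lambda,F$. -}

module Defs where

open import Data.Nat using (ℕ)
open import Data.Bool using (Bool; true; false; _∨_; not)
open import Data.Product using (Σ; _×_; ∃; ∃-syntax; _,_)
open import Data.Sum using (_⊎_)
open import Data.Empty using (⊥)
open import Relation.Nullary using (¬_)
open import Relation.Binary.PropositionalEquality using (_≡_)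
open import Relation.Unary using (Pred; _⊆_; _∪_; _∈_)
open import Level using (0ℓ)

data PTm : Set where
  const : ℕ → PTm
  var   : ℕ → PTm
  _·_   : PTm → PTm → PTm
  _⊕_   : PTm → PTm → PTm
  !_    : PTm → PTm

data JTm : Set where
  e : PTm → JTm

data Fm : Set where
  atom : ℕ → Fm
  ⊥'   : Fm
  _⇒_  : Fm → Fm → Fm
  _∶_  : PTm → Fm → Fm
  [_]_ : JTm → Fm → Fm

infixr 5 _⇒_

¬' : Fm → Fm
¬' A = A ⇒ ⊥'

_∨'_ : Fm → Fm → Fm
A ∨' B = ¬' A ⇒ B

_∧'_ : Fm → Fm → Fm
A ∧' B = ¬' (A ⇒ ¬' B)

data PF : Set where
  pvar : ℕ → PF
  pbot : PF
  pimp : PF → PF → PF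

evalPF : (ℕ → Bool) → PF → Bool
evalPF v (pvar n)   = v n
evalPF v pbot       = false
evalPF v (pimp a b) = not (evalPF v a) ∨ evalPF v b

Tautology : PF → Set
Tautology φ = (v : ℕ → Bool) → evalPF v φ ≡ true

substPF : (ℕ → Fm) → PF → Fm
substPF σ (pvar n)   = σ n
substPF σ pbot       = ⊥'
substPF σ (pimp a b) = substPF σ a ⇒ substPF σ b

TautInstance : Fm → Set
TautInstance F = Σ PF λ φ → Σ (ℕ → Fm) λ σ → Tautology φ × substPF σ φ ≡ F

data Axiom : Fm → Set where
  ax-taut : ∀ {F} → TautInstance F → Axiom F
  ax-j    : ∀ l k F G → Axiom ((l ∶ (F ⇒ G)) ⇒ ((k ∶ F) ⇒ ((l · k) ∶ G)))
  ax-j+   : ∀ l k F → Axiom (((l ∶ F) ∨' (k ∶ F)) ⇒ ((l ⊕ k) ∶ F))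
  ax-jt   : ∀ l F → Axiom ((l ∶ F) ⇒ F)
  ax-j4   : ∀ l F → Axiom ((l ∶ F) ⇒ ((! l) ∶ (l ∶ F)))
  ax-je   : ∀ l F G → Axiom (((l ∶ (F ⇒ G)) ∧' (l ∶ (G ⇒ F))) ⇒ (([ e l ] F) ⇒ ([ e l ] G)))
  ax-je+  : ∀ l k F → Axiom ((([ e l ] F) ∨' ([ e k ] F)) ⇒ ([ e (l ⊕ k) ] F))

-- A constant specification: a set of pairs (α_i, A) (indexed by the
-- constant's number i), each A being an axiom of JE.
ConstSpec : Set₁
ConstSpec = ℕ → Fm → Set

IsConstSpec : ConstSpec → Set
IsConstSpec CS = ∀ i A → CS i A → Axiom A

data _⊢_ (CS : ConstSpec) : Fm → Set where
  axiom : ∀ {F} → Axiom F → CS ⊢ F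
  mp    : ∀ {F G} → CS ⊢ (F ⇒ G) → CS ⊢ F → CS ⊢ G
  nec   : ∀ {i A} → CS i A → CS ⊢ (const i ∶ A)

FmSet : Set₁
FmSet = Pred Fm 0ℓ

_·ˢ_ : FmSet → FmSet → FmSet
(X ·ˢ Y) F = ∃[ G ] ((G ⇒ F) ∈ X × G ∈ Y)

_⊙ˢ_ : FmSet → FmSet → FmSet
(X ⊙ˢ Y) F = ∃[ G ] ((F ⇒ G) ∈ X × (G ⇒ F) ∈ X × G ∈ Y)

_∶ˢ_ : PTm → FmSet → FmSet
(l ∶ˢ X) H = ∃[ F ] (F ∈ X × H ≡ (l ∶ F))

record Evaluation : Set₁ where
  field
    val : ℕ → Bool
    pt  : PTm → FmSet
    jt  : JTm → FmSet

open Evaluation public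

record IsBasicEvaluation (CS : ConstSpec) (ε : Evaluation) : Set₁ where
  field
    app  : ∀ l k → (pt ε l ·ˢ pt ε k) ⊆ pt ε (l · k)
    sum  : ∀ l k → (pt ε l ∪ pt ε k) ⊆ pt ε (l ⊕ k)
    cs   : ∀ i F → CS i F → F ∈ pt ε (const i)
    bang : ∀ l → (l ∶ˢ pt ε l) ⊆ pt ε (! l)
    ee   : ∀ l → (pt ε l ⊙ˢ jt ε (e l)) ⊆ jt ε (e l)
    esum : ∀ l k → (jt ε (e l) ∪ jt ε (e k)) ⊆ jt ε (e (l ⊕ k))

_⊩_ : Evaluation → Fm → Set
ε ⊩ atom n  = val ε n ≡ true
ε ⊩ ⊥'      = ⊥
ε ⊩ (F ⇒ G) = (¬ (ε ⊩ F)) ⊎ (ε ⊩ G)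
ε ⊩ (l ∶ F) = F ∈ pt ε l
ε ⊩ ([ t ] F) = F ∈ jt ε t

record IsBasicModel (CS : ConstSpec) (ε : Evaluation) : Set₁ where
  field
    basic   : IsBasicEvaluation CS ε
    factive : ∀ l F → ε ⊩ (l ∶ F) → ε ⊩ F

-- Soundness: with excluded middle, truth in an evaluation is a Boolean valuation, so
-- tautologies hold, and the closure conditions of a basic model say precisely that the
-- remaining axioms hold.  Completeness is the canonical-model argument: extend {¬F} to a
-- maximal consistent set Γ (Lindenbaum; formulas are enumerated through an injective
-- code into ℕ), and let a term λ justify G iff λ:G ∈ Γ.  Reading the axioms back through
-- the truth lemma shows that this evaluation is a basic model, and it refutes F.
module Submission where

open import Defs
open import Level using (0ℓ)
open import Axiom.ExcludedMiddle using (ExcludedMiddle)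
open import Function.Bundles using (_⇔_; mk⇔; Equivalence)
open import Function using (_∘_; id)
open import Data.Nat using (ℕ; zero; suc; _⊔_; _≤′_; ≤′-refl; ≤′-step)
open import Data.Nat.Properties using (≤⇒≤′; m≤m⊔n; m≤n⊔m)
open import Data.Nat.Binary using (ℕᵇ; 2[1+_]; 1+[2_]; toℕ) renaming (zero to zeroᵇ)
open import Data.Nat.Binary.Properties using (toℕ-injective; 2[1+_]-injective; 1+[2_]-injective)
open import Data.Bool using (true; false; not; _∨_; _≟_)
open import Data.Bool.Properties using (∨-zeroʳ)
open import Data.Product using (Σ; _×_; _,_; proj₁)
open import Data.Sum using (_⊎_; inj₁; inj₂)
open import Data.Empty using (⊥-elim)
open import Relation.Nullary using (¬_; Dec; yes; no; does; ¬?; _⊎-dec_)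
open import Relation.Nullary.Decidable using (dec-true)
open import Relation.Unary using (∅; ｛_｝; _∪_; _⊆_; ⋃)
open import Relation.Binary.PropositionalEquality using (_≡_; refl; sym; trans; cong₂)

open Equivalence

-- The constructors 1+[2_] and 2[1+_] of ℕᵇ serve as the bits 0 and 1 of a prefix-free
-- binary code.
unary : ℕ → ℕᵇ → ℕᵇ
unary zero    = 1+[2_]
unary (suc n) = 2[1+_] ∘ unary n

unary-injective : ∀ m n {x y} → unary m x ≡ unary n y → m ≡ n × x ≡ y
unary-injective zero    zero    eq = refl , 1+[2_]-injective eq
unary-injective (suc m) (suc n) eq with unary-injective m n (2[1+_]-injective eq)
... | refl , refl = refl , refl

mutual
  encodePTm : PTm → ℕᵇ → ℕᵇ
  encodePTm l = unary (tagPTm l) ∘ fieldsPTm l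

  tagPTm : PTm → ℕ
  tagPTm (const _) = 0
  tagPTm (var _)   = 1
  tagPTm (_ · _)   = 2
  tagPTm (_ ⊕ _)   = 3
  tagPTm (! _)     = 4

  fieldsPTm : PTm → ℕᵇ → ℕᵇ
  fieldsPTm (const i) = unary i
  fieldsPTm (var i)   = unary i
  fieldsPTm (l · k)   = encodePTm l ∘ encodePTm k
  fieldsPTm (l ⊕ k)   = encodePTm l ∘ encodePTm k
  fieldsPTm (! l)     = encodePTm l

mutual
  encodePTm-injective : ∀ l k {x y} → encodePTm l x ≡ encodePTm k y → l ≡ k × x ≡ y
  encodePTm-injective l k eq with unary-injective (tagPTm l) (tagPTm k) eq
  ... | tag≡ , fields≡ = fieldsPTm-injective l k tag≡ fields≡

  fieldsPTm-injective : ∀ l k {x y} → tagPTm l ≡ tagPTm k →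
                        fieldsPTm l x ≡ fieldsPTm k y → l ≡ k × x ≡ y
  fieldsPTm-injective (const i) (const j) refl eq with unary-injective i j eq
  ... | refl , refl = refl , refl
  fieldsPTm-injective (var i) (var j) refl eq with unary-injective i j eq
  ... | refl , refl = refl , refl
  fieldsPTm-injective (l · l′) (k · k′) refl eq with encodePTm-injective l k eq
  ... | refl , eq′ with encodePTm-injective l′ k′ eq′
  ... | refl , refl = refl , refl
  fieldsPTm-injective (l ⊕ l′) (k ⊕ k′) refl eq with encodePTm-injective l k eq
  ... | refl , eq′ with encodePTm-injective l′ k′ eq′
  ... | refl , refl = refl , refl
  fieldsPTm-injective (! l) (! k) refl eq with encodePTm-injective l k eq
  ... | refl , refl = refl , refl

mutual
  encodeFm : Fm → ℕᵇ → ℕᵇ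
  encodeFm F = unary (tagFm F) ∘ fieldsFm F

  tagFm : Fm → ℕ
  tagFm (atom _)  = 0
  tagFm ⊥'        = 1
  tagFm (_ ⇒ _)   = 2
  tagFm (_ ∶ _)   = 3
  tagFm ([ _ ] _) = 4

  fieldsFm : Fm → ℕᵇ → ℕᵇ
  fieldsFm (atom n)      = unary n
  fieldsFm ⊥'            = id
  fieldsFm (A ⇒ B)       = encodeFm A ∘ encodeFm B
  fieldsFm (l ∶ A)       = encodePTm l ∘ encodeFm A
  fieldsFm ([ e l ] A)   = encodePTm l ∘ encodeFm A

mutual
  encodeFm-injective : ∀ F G {x y} → encodeFm F x ≡ encodeFm G y → F ≡ G × x ≡ y
  encodeFm-injective F G eq with unary-injective (tagFm F) (tagFm G) eq
  ... | tag≡ , fields≡ = fieldsFm-injective F G tag≡ fields≡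

  fieldsFm-injective : ∀ F G {x y} → tagFm F ≡ tagFm G →
                       fieldsFm F x ≡ fieldsFm G y → F ≡ G × x ≡ y
  fieldsFm-injective (atom m) (atom n) refl eq with unary-injective m n eq
  ... | refl , refl = refl , refl
  fieldsFm-injective ⊥' ⊥' refl eq = refl , eq
  fieldsFm-injective (A ⇒ A′) (B ⇒ B′) refl eq with encodeFm-injective A B eq
  ... | refl , eq′ with encodeFm-injective A′ B′ eq′
  ... | refl , refl = refl , refl
  fieldsFm-injective (l ∶ A) (k ∶ B) refl eq with encodePTm-injective l k eq
  ... | refl , eq′ with encodeFm-injective A B eq′
  ... | refl , refl = refl , refl
  fieldsFm-injective ([ e l ] A) ([ e k ] B) refl eq with encodePTm-injective l k eq
  ... | refl , eq′ with encodeFm-injective A B eq′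
  ... | refl , refl = refl , refl

code : Fm → ℕ
code F = toℕ (encodeFm F zeroᵇ)

code-injective : ∀ {F G} → code F ≡ code G → F ≡ G
code-injective {F} {G} eq = proj₁ (encodeFm-injective F G (toℕ-injective eq))

infix 3 _⊢[_]_

data _⊢[_]_ (Δ : FmSet) (CS : ConstSpec) : Fm → Set where
  hyp   : ∀ {F} → Δ F → Δ ⊢[ CS ] F
  axiom : ∀ {F} → Axiom F → Δ ⊢[ CS ] F
  mp    : ∀ {F G} → Δ ⊢[ CS ] (F ⇒ G) → Δ ⊢[ CS ] F → Δ ⊢[ CS ] G
  nec   : ∀ {i A} → CS i A → Δ ⊢[ CS ] (const i ∶ A)

Consistent : ConstSpec → FmSet → Set
Consistent CS Δ = ¬ (Δ ⊢[ CS ] ⊥')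

record IsMaximalConsistent (CS : ConstSpec) (Γ : FmSet) : Set where
  field
    consistent : Consistent CS Γ
    closed     : ∀ {A} → Γ ⊢[ CS ] A → Γ A
    maximal    : ∀ {A} → ¬ Γ A → Γ (¬' A)

module _ {CS : ConstSpec} where

  weaken : ∀ {Δ Δ′ A} → Δ ⊆ Δ′ → Δ ⊢[ CS ] A → Δ′ ⊢[ CS ] A
  weaken Δ⊆Δ′ (hyp h)   = hyp (Δ⊆Δ′ h)
  weaken Δ⊆Δ′ (axiom a) = axiom a
  weaken Δ⊆Δ′ (mp d d′) = mp (weaken Δ⊆Δ′ d) (weaken Δ⊆Δ′ d′)
  weaken Δ⊆Δ′ (nec c)   = nec c

  ∅⊢⇒⊢ : ∀ {A} → ∅ ⊢[ CS ] A → CS ⊢ A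
  ∅⊢⇒⊢ (axiom a) = axiom a
  ∅⊢⇒⊢ (mp d d′) = mp (∅⊢⇒⊢ d) (∅⊢⇒⊢ d′)
  ∅⊢⇒⊢ (nec c)   = nec c

tautology : ∀ φ → Tautology φ → ∀ σ → Axiom (substPF σ φ)
tautology φ taut σ = ax-taut (φ , σ , taut , refl)

⟨_,_,_⟩ : Fm → Fm → Fm → ℕ → Fm
⟨ A , B , C ⟩ 0 = A
⟨ A , B , C ⟩ 1 = B
⟨ A , B , C ⟩ _ = C

p₀ p₁ p₂ : PF
p₀ = pvar 0
p₁ = pvar 1
p₂ = pvar 2

axiom-K : ∀ A B → Axiom (A ⇒ B ⇒ A)
axiom-K A B = tautology (pimp p₀ (pimp p₁ p₀)) (λ v → K (v 0) (v 1)) ⟨ A , B , ⊥' ⟩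
  where
  K : ∀ a b → not a ∨ (not b ∨ a) ≡ true
  K false _ = refl
  K true  b = ∨-zeroʳ (not b)

axiom-DN : ∀ A → Axiom (¬' (¬' A) ⇒ A)
axiom-DN A = tautology (pimp (pimp (pimp p₀ pbot) pbot) p₀) (λ v → DN (v 0)) ⟨ A , ⊥' , ⊥' ⟩
  where
  DN : ∀ a → not (not (not a ∨ false) ∨ false) ∨ a ≡ true
  DN false = refl
  DN true  = refl

axiom-EFQ : ∀ A B → Axiom (¬' A ⇒ A ⇒ B)
axiom-EFQ A B = tautology (pimp (pimp p₀ pbot) (pimp p₀ p₁)) (λ v → EFQ (v 0) (v 1)) ⟨ A , B , ⊥' ⟩
  where
  EFQ : ∀ a b → not (not a ∨ false) ∨ (not a ∨ b) ≡ true
  EFQ false _ = refl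
  EFQ true  _ = refl

axiom-S : ∀ A B C → Axiom ((A ⇒ B ⇒ C) ⇒ (A ⇒ B) ⇒ A ⇒ C)
axiom-S A B C = tautology (pimp (pimp p₀ (pimp p₁ p₂)) (pimp (pimp p₀ p₁) (pimp p₀ p₂)))
                (λ v → S (v 0) (v 1) (v 2)) ⟨ A , B , C ⟩
  where
  S : ∀ a b c → not (not a ∨ (not b ∨ c)) ∨ (not (not a ∨ b) ∨ (not a ∨ c)) ≡ true
  S false _     _     = refl
  S true  false _     = refl
  S true  true  false = refl
  S true  true  true  = refl

deduction : ∀ {CS Δ A B} → Δ ∪ ｛ A ｝ ⊢[ CS ] B → Δ ⊢[ CS ] (A ⇒ B)
deduction (hyp (inj₁ h))            = mp (axiom (axiom-K _ _)) (hyp h)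
deduction {A = A} (hyp (inj₂ refl)) =
  mp (mp (axiom (axiom-S A (A ⇒ A) A)) (axiom (axiom-K A (A ⇒ A)))) (axiom (axiom-K A A))
deduction (axiom a)                 = mp (axiom (axiom-K _ _)) (axiom a)
deduction (nec c)                   = mp (axiom (axiom-K _ _)) (nec c)
deduction (mp d d′)                 = mp (mp (axiom (axiom-S _ _ _)) (deduction d)) (deduction d′)

¬⊢⇒consistent-¬ : ∀ {CS F} → ¬ CS ⊢ F → Consistent CS ｛ ¬' F ｝
¬⊢⇒consistent-¬ ⊬F d = ⊬F (∅⊢⇒⊢ (mp (axiom (axiom-DN _)) (deduction (weaken inj₂ d))))

does≡true⇒ : ∀ {P : Set} (p? : Dec P) → does p? ≡ true → P
does≡true⇒ (yes p) _ = p

module _ (lem : ExcludedMiddle 0ℓ) where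

  module _ (ε : Evaluation) where

    ⊩? : ∀ F → Dec (ε ⊩ F)
    ⊩? (atom n)  = val ε n ≟ true
    ⊩? ⊥'        = no λ ()
    ⊩? (A ⇒ B)   = ¬? (⊩? A) ⊎-dec ⊩? B
    ⊩? (l ∶ A)   = lem
    ⊩? ([ t ] A) = lem

    ⊩-⇒ : ∀ A B → ε ⊩ (A ⇒ B) ⇔ (ε ⊩ A → ε ⊩ B)
    ⊩-⇒ A B = mk⇔ elim intro
      where
      elim : ε ⊩ (A ⇒ B) → ε ⊩ A → ε ⊩ B
      elim (inj₁ ⊮A) ⊩A = ⊥-elim (⊮A ⊩A)
      elim (inj₂ ⊩B) _  = ⊩B
      intro : (ε ⊩ A → ε ⊩ B) → ε ⊩ (A ⇒ B)
      intro f with ⊩? A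
      ... | yes ⊩A = inj₂ (f ⊩A)
      ... | no ⊮A  = inj₁ ⊮A

    ⊩-¬ : ∀ A → ε ⊩ ¬' A ⇔ (¬ ε ⊩ A)
    ⊩-¬ A = ⊩-⇒ A ⊥'

    ⊩-∨ : ∀ A B → ε ⊩ (A ∨' B) ⇔ (ε ⊩ A ⊎ ε ⊩ B)
    ⊩-∨ A B = mk⇔ elim intro
      where
      elim : ε ⊩ (A ∨' B) → ε ⊩ A ⊎ ε ⊩ B
      elim h with ⊩? A
      ... | yes ⊩A = inj₁ ⊩A
      ... | no ⊮A  = inj₂ (⊩-⇒ (¬' A) B .to h (⊩-¬ A .from ⊮A))
      intro : ε ⊩ A ⊎ ε ⊩ B → ε ⊩ (A ∨' B)
      intro (inj₁ ⊩A) = ⊩-⇒ (¬' A) B .from λ ⊩¬A → ⊥-elim (⊩-¬ A .to ⊩¬A ⊩A)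
      intro (inj₂ ⊩B) = inj₂ ⊩B

    ⊩-∧ : ∀ A B → ε ⊩ (A ∧' B) ⇔ (ε ⊩ A × ε ⊩ B)
    ⊩-∧ A B = mk⇔ elim intro
      where
      elim : ε ⊩ (A ∧' B) → ε ⊩ A × ε ⊩ B
      elim h with ⊩? A | ⊩? B
      ... | yes ⊩A | yes ⊩B = ⊩A , ⊩B
      ... | no ⊮A  | _      = ⊥-elim (⊩-¬ (A ⇒ ¬' B) .to h (inj₁ ⊮A))
      ... | _      | no ⊮B  = ⊥-elim (⊩-¬ (A ⇒ ¬' B) .to h (inj₂ (inj₁ ⊮B)))
      intro : ε ⊩ A × ε ⊩ B → ε ⊩ (A ∧' B)
      intro (⊩A , ⊩B) = ⊩-¬ (A ⇒ ¬' B) .from λ h → ⊩-¬ B .to (⊩-⇒ A (¬' B) .to h ⊩A) ⊩B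

    evalPF-substPF : ∀ σ φ → evalPF (does ∘ ⊩? ∘ σ) φ ≡ does (⊩? (substPF σ φ))
    evalPF-substPF σ (pvar n)   = refl
    evalPF-substPF σ pbot       = refl
    evalPF-substPF σ (pimp φ ψ) =
      cong₂ (λ a b → not a ∨ b) (evalPF-substPF σ φ) (evalPF-substPF σ ψ)

    ⊩-tautInstance : ∀ {F} → TautInstance F → ε ⊩ F
    ⊩-tautInstance (φ , σ , taut , refl) =
      does≡true⇒ (⊩? (substPF σ φ)) (trans (sym (evalPF-substPF σ φ)) (taut (does ∘ ⊩? ∘ σ)))

  -- Basic models are exactly the evaluations validating the axioms

  module _ {CS : ConstSpec} {ε : Evaluation} (M : IsBasicModel CS ε) where
    open IsBasicModel M
    open IsBasicEvaluation basic

    ⊩-axiom : ∀ {A} → Axiom A → ε ⊩ A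
    ⊩-axiom (ax-taut i)    = ⊩-tautInstance ε i
    ⊩-axiom (ax-j l k F G) =
      ⊩-⇒ ε (l ∶ (F ⇒ G)) ((k ∶ F) ⇒ ((l · k) ∶ G)) .from λ ⊩lFG →
      ⊩-⇒ ε (k ∶ F) ((l · k) ∶ G) .from λ ⊩kF → app l k (F , ⊩lFG , ⊩kF)
    ⊩-axiom (ax-j+ l k F)  =
      ⊩-⇒ ε ((l ∶ F) ∨' (k ∶ F)) ((l ⊕ k) ∶ F) .from (sum l k ∘ ⊩-∨ ε (l ∶ F) (k ∶ F) .to)
    ⊩-axiom (ax-jt l F)    = ⊩-⇒ ε (l ∶ F) F .from (factive l F)
    ⊩-axiom (ax-j4 l F)    =
      ⊩-⇒ ε (l ∶ F) ((! l) ∶ (l ∶ F)) .from λ ⊩lF → bang l (F , ⊩lF , refl)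
    ⊩-axiom (ax-je l F G)  =
      ⊩-⇒ ε ((l ∶ (F ⇒ G)) ∧' (l ∶ (G ⇒ F))) (([ e l ] F) ⇒ ([ e l ] G)) .from λ h →
      ⊩-⇒ ε ([ e l ] F) ([ e l ] G) .from λ ⊩F →
      let (⊩lFG , ⊩lGF) = ⊩-∧ ε (l ∶ (F ⇒ G)) (l ∶ (G ⇒ F)) .to h in ee l (F , ⊩lGF , ⊩lFG , ⊩F)
    ⊩-axiom (ax-je+ l k F) =
      ⊩-⇒ ε (([ e l ] F) ∨' ([ e k ] F)) ([ e (l ⊕ k) ] F) .from
        (esum l k ∘ ⊩-∨ ε ([ e l ] F) ([ e k ] F) .to)

    sound : ∀ {A} → CS ⊢ A → ε ⊩ A
    sound (axiom a)         = ⊩-axiom a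
    sound (mp {F} {G} d d′) = ⊩-⇒ ε F G .to (sound d) (sound d′)
    sound (nec {i} {A} c)   = cs i A c

  axioms⇒isBasicModel : ∀ {CS ε} → (∀ {A} → Axiom A → ε ⊩ A) →
                        (∀ i A → CS i A → ε ⊩ (const i ∶ A)) → IsBasicModel CS ε
  axioms⇒isBasicModel {ε = ε} ⊩ax ⊩cs = record
    { basic   = record
      { app  = λ l k {G} → λ { (F , ⊩lFG , ⊩kF) → byAxiom₂ (ax-j l k F G) ⊩lFG ⊩kF }
      ; sum  = λ l k {F} → byAxiom (ax-j+ l k F) ∘ ⊩-∨ ε (l ∶ F) (k ∶ F) .from
      ; cs   = ⊩cs
      ; bang = λ l → λ { (F , ⊩lF , refl) → byAxiom (ax-j4 l F) ⊩lF }
      ; ee   = λ l {G} → λ { (F , ⊩lGF , ⊩lFG , ⊩F) →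
                 byAxiom₂ (ax-je l F G) (⊩-∧ ε (l ∶ (F ⇒ G)) (l ∶ (G ⇒ F)) .from (⊩lFG , ⊩lGF)) ⊩F }
      ; esum = λ l k {F} → byAxiom (ax-je+ l k F) ∘ ⊩-∨ ε ([ e l ] F) ([ e k ] F) .from
      }
    ; factive = λ l F → byAxiom (ax-jt l F)
    }
    where
    byAxiom : ∀ {A B} → Axiom (A ⇒ B) → ε ⊩ A → ε ⊩ B
    byAxiom {A} {B} a = ⊩-⇒ ε A B .to (⊩ax a)
    byAxiom₂ : ∀ {A B C} → Axiom (A ⇒ B ⇒ C) → ε ⊩ A → ε ⊩ B → ε ⊩ C
    byAxiom₂ {A} {B} {C} a = ⊩-⇒ ε B C .to ∘ byAxiom a

  -- Lindenbaum's lemma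

  -- Injectivity of code ensures that each stage adds at most one formula.
  module Lindenbaum {CS : ConstSpec} {Δ : FmSet} (Δ-consistent : Consistent CS Δ) where

    stage : ℕ → FmSet
    stage zero    = Δ
    stage (suc n) = stage n ∪ λ G → code G ≡ n × Consistent CS (stage n ∪ ｛ G ｝)

    stage-consistent : ∀ n → Consistent CS (stage n)
    stage-consistent zero    = Δ-consistent
    stage-consistent (suc n) d
      with lem {Σ Fm λ G → code G ≡ n × Consistent CS (stage n ∪ ｛ G ｝)}
    ... | no nothing-admitted = stage-consistent n (weaken stage-unchanged d)
      where
      stage-unchanged : stage (suc n) ⊆ stage n
      stage-unchanged (inj₁ s)        = s
      stage-unchanged (inj₂ admitted) = ⊥-elim (nothing-admitted (_ , admitted))
    ... | yes (G , refl , G-consistent) = G-consistent (weaken only-G-added d)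
      where
      only-G-added : stage (suc n) ⊆ stage n ∪ ｛ G ｝
      only-G-added (inj₁ s)            = inj₁ s
      only-G-added (inj₂ (code≡ , _)) = inj₂ (code-injective (sym code≡))

    stage-mono : ∀ {m n} → m ≤′ n → stage m ⊆ stage n
    stage-mono ≤′-refl        = id
    stage-mono (≤′-step m≤′n) = inj₁ ∘ stage-mono m≤′n

    Γ : FmSet
    Γ = ⋃ ℕ stage

    compact : ∀ {A} → Γ ⊢[ CS ] A → Σ ℕ λ n → stage n ⊢[ CS ] A
    compact (hyp (n , s)) = n , hyp s
    compact (axiom a)     = 0 , axiom a
    compact (nec c)       = 0 , nec c
    compact (mp d d′) with compact d | compact d′
    ... | m , dₘ | n , dₙ = m ⊔ n ,
      mp (weaken (stage-mono (≤⇒≤′ (m≤m⊔n m n))) dₘ) (weaken (stage-mono (≤⇒≤′ (m≤n⊔m m n))) dₙ)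

    Γ-consistent : Consistent CS Γ
    Γ-consistent d with compact d
    ... | n , dₙ = stage-consistent n dₙ

    Γ-decides : ∀ G → Γ G ⊎ Γ ⊢[ CS ] ¬' G
    Γ-decides G with lem {stage (code G) ∪ ｛ G ｝ ⊢[ CS ] ⊥'}
    ... | yes d           = inj₂ (weaken (code G ,_) (deduction d))
    ... | no G-consistent = inj₁ (suc (code G) , inj₂ (refl , G-consistent))

    Γ-closed : ∀ {A} → Γ ⊢[ CS ] A → Γ A
    Γ-closed {A} d with Γ-decides A
    ... | inj₁ A∈Γ = A∈Γ
    ... | inj₂ d¬A = ⊥-elim (Γ-consistent (mp d¬A d))

    Γ-maximal : ∀ {A} → ¬ Γ A → Γ (¬' A)
    Γ-maximal {A} A∉Γ with Γ-decides A
    ... | inj₁ A∈Γ = ⊥-elim (A∉Γ A∈Γ)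
    ... | inj₂ d¬A = Γ-closed d¬A

  lindenbaum : ∀ {CS Δ} → Consistent CS Δ → Σ FmSet λ Γ → Δ ⊆ Γ × IsMaximalConsistent CS Γ
  lindenbaum Δ-consistent = Γ , (0 ,_) , record
    { consistent = Γ-consistent ; closed = Γ-closed ; maximal = Γ-maximal }
    where open Lindenbaum Δ-consistent

  -- The canonical model

  module Canonical {CS : ConstSpec} {Γ : FmSet} (mc : IsMaximalConsistent CS Γ) where
    open IsMaximalConsistent mc

    canonical : Evaluation
    canonical = record
      { val = λ n → does (lem {Γ (atom n)})
      ; pt  = λ l A → Γ (l ∶ A)
      ; jt  = λ t A → Γ ([ t ] A)
      }

    Γ-mp : ∀ {A B} → Γ (A ⇒ B) → Γ A → Γ B
    Γ-mp A⇒B∈Γ A∈Γ = closed (mp (hyp A⇒B∈Γ) (hyp A∈Γ))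

    Γ-axiom : ∀ {A} → Axiom A → Γ A
    Γ-axiom a = closed (axiom a)

    truth : ∀ A → canonical ⊩ A ⇔ Γ A
    truth (atom n)  = mk⇔ (does≡true⇒ lem) (dec-true lem)
    truth ⊥'        = mk⇔ (λ ()) (consistent ∘ hyp)
    truth (A ⇒ B)   = mk⇔ intro elim
      where
      intro : canonical ⊩ (A ⇒ B) → Γ (A ⇒ B)
      intro (inj₁ ⊮A) = Γ-mp (Γ-axiom (axiom-EFQ A B)) (maximal (⊮A ∘ truth A .from))
      intro (inj₂ ⊩B) = Γ-mp (Γ-axiom (axiom-K B A)) (truth B .to ⊩B)
      elim : Γ (A ⇒ B) → canonical ⊩ (A ⇒ B)
      elim A⇒B∈Γ = ⊩-⇒ canonical A B .from (truth B .from ∘ Γ-mp A⇒B∈Γ ∘ truth A .to)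
    truth (l ∶ A)   = mk⇔ id id
    truth ([ t ] A) = mk⇔ id id

    canonical-isBasicModel : IsBasicModel CS canonical
    canonical-isBasicModel =
      axioms⇒isBasicModel (truth _ .from ∘ Γ-axiom) (λ i A c → closed (nec c))

  complete : ∀ {CS F} → (∀ ε → IsBasicModel CS ε → ε ⊩ F) → CS ⊢ F
  complete {CS} {F} valid with lem {CS ⊢ F}
  ... | yes ⊢F = ⊢F
  ... | no ⊬F with lindenbaum (¬⊢⇒consistent-¬ ⊬F)
  ... | Γ , ¬F∈Γ , mc =
    ⊥-elim (⊩-¬ canonical F .to (truth (¬' F) .from (¬F∈Γ refl)) (valid canonical canonical-isBasicModel))
    where open Canonical mc

mainTheorem1 : ExcludedMiddle 0ℓ → (CS : ConstSpec) → IsConstSpec CS → (F : Fm) → (CS ⊢ F) ⇔ ((ε : Evaluation) → IsBasicModel CS ε → ε ⊩ F)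
mainTheorem1 lem CS _ F = mk⇔ (λ ⊢F ε M → sound lem M ⊢F) (complete lem)
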